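{- Let $\mathit{Act}$ be a set of actions containing the silent action $\tau$, and let $\mathcal{A}$ be the boolean algebra $(\mathcal{P}(\mathit{Act}),+,\cdot,\bar{\ },0,1)$, where $+$ is union, $\cdot$ is intersection, $0=\emptyset$ and $1=\mathit{Act}$. Let $(\sigma,A,S,\rho)$ be a transition system of dimension $n$ with silent steps, i.e. $\sigma\in\{0,1\}^{1\times n}$ has exactly one non-zero entry, $A\in\mathcal{A}^{n\times n}$ satisfies $\{\tau\}\cdot A=0$, $S\in\{0,1\}^{n\times n}$, and $\rho\in\{0,1\}^{n\times 1}$. Let $\Pi=S^*$. Let $V\in\{0,1\}^{n\times N}$ be a collector matrix that is a weak bisimulation on $(\sigma,A,S,\rho)$, i.e. there is a distributor $U$ for $V$ such that \[VU\Pi V=\Pi V,\qquad VU\Pi A\Pi V=\Pi A\Pi V,\qquad VU\Pi\rho=\Pi\rho.\] Then, with $V^{T}$ the transpose of $V$, \[(V^{T}SV)^*\,V^{T}AV\,(V^{T}SV)^*=V^{T}\Pi A\Pi V\qquad\text{and}\qquad V^{T}\Pi\rho=(V^{T}SV)^*\,V^{T}\rho,\] i.e. $\tau$-closing the weakly lumped system $(\sigma V, V^{T}AV, V^{T}SV, V^{T}\rho)$ gives the same result as lumping by $V$ (with distributor $V^T$) the $\tau$-closed system.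
   Context: All matrices have entries in $\mathcal{A}$ (the $0$--$1$ matrices are those with entries in $\{\emptyset,\mathit{Act}\}$), with matrix sum and product defined as usual using $+$ and $\cdot$ of $\mathcal{A}$. For a $0$--$1$ square matrix $R$, $R^*=\sum_{k\ge0}R^k$ with $R^0=I$. A collector is a $0$--$1$ matrix $V\in\{0,1\}^{n\times N}$, $n\ge N$, in which every row contains exactly one $1$. A distributor for $V$ is a matrix $U\in\mathcal{A}^{N\times n}$ with $U\mathbf{1}=\mathbf{1}$ (all-ones column vector) and $UV=I^N$. -}

module Defs where

open import Data.Nat using (ℕ; zero; suc; _≤_)
open import Data.Fin using (Fin)
import Data.Fin
open import Data.Product using (Σ; _×_; ∃)
open import Data.Sum using (_⊎_)
open import Data.Empty using (⊥)
open import Relation.Nullary using (¬_)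
open import Relation.Binary.PropositionalEquality using (_≡_)
open import Function.Bundles using (_⇔_)

-- The boolean algebra 𝒜 = 𝒫(Act): a subset of Act is a predicate Act → Set.
-- + is union, · is intersection, 0 = ∅, 1 = Act.
Sub : Set → Set₁
Sub Act = Act → Set

Mat : Set → ℕ → ℕ → Set₁
Mat Act m n = Fin m → Fin n → Sub Act

module _ {Act : Set} where

  _⊕_ : ∀ {m n} → Mat Act m n → Mat Act m n → Mat Act m n
  (M ⊕ N) i j a = M i j a ⊎ N i j a

  _⊗_ : ∀ {m n k} → Mat Act m n → Mat Act n k → Mat Act m k
  (M ⊗ N) i k a = Σ (Fin _) λ j → M i j a × N j k a

  infixl 6 _⊕_
  infixl 7 _⊗_

  I : ∀ {n} → Mat Act n n
  I i j a = i ≡ j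

  𝟏 : ∀ {n} → Mat Act n 1
  𝟏 i j a = Data.Unit.⊤
    where import Data.Unit

  transpose : ∀ {m n} → Mat Act m n → Mat Act n m
  transpose M i j = M j i

  pow : ∀ {n} → Mat Act n n → ℕ → Mat Act n n
  pow R zero = I
  pow R (suc k) = pow R k ⊗ R

  star : ∀ {n} → Mat Act n n → Mat Act n n
  star R i j a = Σ ℕ λ k → pow R k i j a

  _≈_ : ∀ {m n} → Mat Act m n → Mat Act m n → Set
  M ≈ N = ∀ i j a → M i j a ⇔ N i j a

  infix 4 _≈_

  IsZero IsOne : Sub Act → Set
  IsZero X = ∀ a → ¬ X a
  IsOne X = ∀ a → X a

  Is01 : ∀ {m n} → Mat Act m n → Set
  Is01 M = ∀ i j → IsZero (M i j) ⊎ IsOne (M i j)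

  ExactlyOneNonZero : ∀ {n} → Mat Act 1 n → Set
  ExactlyOneNonZero σ = Σ (Fin _) λ j → ¬ IsZero (σ Data.Fin.zero j) × (∀ j' → ¬ j' ≡ j → IsZero (σ Data.Fin.zero j'))

  record IsTSSilent (τ : Act) {n : ℕ} (σ : Mat Act 1 n) (A : Mat Act n n)
                    (S : Mat Act n n) (ρ : Mat Act n 1) : Set where
    field
      σ-01     : Is01 σ
      σ-single : ExactlyOneNonZero σ
      A-noτ    : (λ i j a → (a ≡ τ) × A i j a) ≈ (λ i j a → ⊥)   -- {τ}·A = 0
      S-01     : Is01 S
      ρ-01     : Is01 ρ

  record IsCollector {n N : ℕ} (V : Mat Act n N) : Set where
    field
      N≤n     : N ≤ n
      V-01    : Is01 V
      rowOne  : ∀ i → Σ (Fin N) λ j → IsOne (V i j) × (∀ j' → ¬ j' ≡ j → IsZero (V i j'))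

  record IsDistributor {n N : ℕ} (V : Mat Act n N) (U : Mat Act N n) : Set where
    field
      U𝟏 : U ⊗ 𝟏 ≈ 𝟏
      UV : U ⊗ V ≈ I

  record IsWeakBisimVia {n N : ℕ} (A S : Mat Act n n) (ρ : Mat Act n 1)
                        (V : Mat Act n N) (U : Mat Act N n) : Set where
    field
      distr : IsDistributor V U
      eq₁ : V ⊗ U ⊗ star S ⊗ V ≈ star S ⊗ V
      eq₂ : V ⊗ U ⊗ star S ⊗ A ⊗ star S ⊗ V ≈ star S ⊗ A ⊗ star S ⊗ V
      eq₃ : V ⊗ U ⊗ star S ⊗ ρ ≈ star S ⊗ ρ

-- Write block i for the unique column of row i of V.  An S-path from i to x
-- projects to a path of VᵀSV from block i to block x, which gives one inclusion
-- of each identity.  Conversely, a row of V ⊗ M depends only on the block of the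
-- row index, so the bisimulation equations V U X = X say that X = ΠV, ΠAΠV, Πρ
-- are constant on blocks.  For ΠV this lets a path of VᵀSV be lifted, step by
-- step, to an S-path from any state of its first block; UV = I makes every block
-- inhabited, so there always is such a state.
module Submission where

open import Defs
open import Data.Nat using (ℕ; zero; suc)
open import Data.Fin using (Fin; _≟_)
open import Data.Product using (Σ; _×_; _,_; proj₁; proj₂)
open import Data.Empty using (⊥-elim)
open import Relation.Nullary using (yes; no)
open import Relation.Binary.PropositionalEquality using (_≡_; refl; sym; trans; subst)
open import Function.Bundles using (mk⇔; Equivalence)
open Equivalence using (to; from)

module _ {Act : Set} where

  _⊆_ : ∀ {m n} → Mat Act m n → Mat Act m n → Set
  M ⊆ M' = ∀ {i j a} → M i j a → M' i j a

  infix 4 _⊆_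

  record LeftClosed {m n} (R : Mat Act m m) (Y : Mat Act m n) : Set where
    constructor leftClosed
    field close : ∀ {i j l a} → R i j a → Y j l a → Y i l a

  open LeftClosed public

  ⊗-leftClosed : ∀ {m n k} {R : Mat Act m m} {Y : Mat Act m n} {Z : Mat Act n k} →
                 LeftClosed R Y → LeftClosed R (Y ⊗ Z)
  ⊗-leftClosed Y-closed = leftClosed λ r (j , y , z) → j , close Y-closed r y , z

  leftClosed-resp-≈ : ∀ {m n} {R : Mat Act m m} {Y Z : Mat Act m n} →
                      Y ≈ Z → LeftClosed R Y → LeftClosed R Z
  leftClosed-resp-≈ Y≈Z Y-closed = leftClosed λ {i} {j} {l} {a} r z →
    to (Y≈Z i l a) (close Y-closed r (from (Y≈Z j l a) z))

  module _ {m : ℕ} {R : Mat Act m m} where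

    star-refl : ∀ {i a} → star R i i a
    star-refl = 0 , refl

    star-snoc : ∀ {i j k a} → star R i j a → R j k a → star R i k a
    star-snoc {j = j} (t , p) r = suc t , (j , p , r)

    star-step : ∀ {i j a} → R i j a → star R i j a
    star-step = star-snoc star-refl

    star-trans : ∀ {i j k a} → star R i j a → star R j k a → star R i k a
    star-trans {i} {j} {a = a} p (t , q) = go t q
      where
      go : ∀ {k} t → pow R t j k a → star R i k a
      go zero refl = p
      go (suc t) (w , q , r) = star-snoc (go t q) r

    star-leftClosed : LeftClosed (star R) (star R)
    star-leftClosed = leftClosed star-trans

module Lumping {Act : Set} {n N : ℕ} (V : Mat Act n N) (col : IsCollector V) where

  open IsCollector col

  block : Fin n → Fin N
  block i = proj₁ (rowOne i)

  V-block : ∀ i {a} → V i (block i) a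
  V-block i = proj₁ (proj₂ (rowOne i)) _

  V⇒≡block : ∀ {i k a} → V i k a → k ≡ block i
  V⇒≡block {i} {k} {a} v with k ≟ block i
  ... | yes k≡block = k≡block
  ... | no k≢block = ⊥-elim (proj₂ (proj₂ (rowOne i)) k k≢block a v)

  V-functional : ∀ {i k l a} → V i k a → V i l a → k ≡ l
  V-functional vk vl = trans (V⇒≡block vk) (sym (V⇒≡block vl))

  SameBlock : Mat Act n n
  SameBlock = V ⊗ transpose V

  V-leftClosed : LeftClosed SameBlock V
  V-leftClosed = leftClosed λ {a = a} (k , vik , vjk) vjl →
    subst (λ k' → V _ k' a) (V-functional vjk vjl) vik

  lump : Mat Act n n → Mat Act N N
  lump R = transpose V ⊗ R ⊗ V

  lump-star⊆star-lump : ∀ {R : Mat Act n n} → lump (star R) ⊆ star (lump R)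
  lump-star⊆star-lump {R} (x , (i , vik , (t , p)) , vxl) = go t vik p vxl
    where
    go : ∀ {i x k l a} t → V i k a → pow R t i x a → V x l a → star (lump R) k l a
    go {k = k} {a = a} zero vik refl vil =
      subst (λ l → star (lump R) k l a) (V-functional vik vil) star-refl
    go (suc t) vik (w , p , r) vxl =
      star-snoc (go t vik p (V-block w)) (_ , (w , V-block w , r) , vxl)

  module _ {R : Mat Act n n} (blockInvariant : LeftClosed SameBlock (star R ⊗ V)) where

    V⊗star-lump⊆star⊗V : V ⊗ star (lump R) ⊆ star R ⊗ V
    V⊗star-lump⊆star⊗V {x} {a = a} (k , vxk , (t , q)) = go t q
      where
      go : ∀ {p} t → pow (lump R) t k p a → (star R ⊗ V) x p a
      go zero refl = x , star-refl , vxk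
      go (suc t) (p' , q , (y' , (i , vip' , r) , vy'p)) =
        let (y , πxy , vyp') = go t q
            (z , πyz , vzp) = close blockInvariant (p' , vyp' , vip') (y' , star-step r , vy'p)
        in z , star-trans πxy πyz , vzp

    leftClosed-lumpedPath : ∀ {m} {Y : Mat Act n m} →
      LeftClosed SameBlock Y → LeftClosed (star R) Y →
      LeftClosed (V ⊗ star (lump R) ⊗ transpose V) Y
    leftClosed-lumpedPath sameBlock-closed star-closed = leftClosed λ (p , path , vip) y →
      let (z , πxz , vzp) = V⊗star-lump⊆star⊗V path
      in close star-closed πxz (close sameBlock-closed (p , vzp , vip) y)

module WeakBisimulation {Act : Set} {n N : ℕ} {A S : Mat Act n n} {ρ : Mat Act n 1}
  {V : Mat Act n N} {U : Mat Act N n}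
  (col : IsCollector V) (bisim : IsWeakBisimVia A S ρ V U) where

  open Lumping V col
  open IsWeakBisimVia bisim

  block-inhabited : ∀ k {a} → Σ (Fin n) λ x → V x k a
  block-inhabited k {a} =
    let (x , _ , vxk) = from (IsDistributor.UV distr k k a) refl in x , vxk

  Π : Mat Act n n
  Π = star S

  Q : Mat Act N N
  Q = lump S

  ΠV-blockInvariant : LeftClosed SameBlock (Π ⊗ V)
  ΠV-blockInvariant =
    leftClosed-resp-≈ eq₁ (⊗-leftClosed (⊗-leftClosed (⊗-leftClosed V-leftClosed)))

  ΠAΠV-blockInvariant : LeftClosed SameBlock (Π ⊗ A ⊗ Π ⊗ V)
  ΠAΠV-blockInvariant = leftClosed-resp-≈ eq₂
    (⊗-leftClosed (⊗-leftClosed (⊗-leftClosed (⊗-leftClosed (⊗-leftClosed V-leftClosed)))))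

  Πρ-blockInvariant : LeftClosed SameBlock (Π ⊗ ρ)
  Πρ-blockInvariant =
    leftClosed-resp-≈ eq₃ (⊗-leftClosed (⊗-leftClosed (⊗-leftClosed V-leftClosed)))

  lift : V ⊗ star Q ⊆ Π ⊗ V
  lift = V⊗star-lump⊆star⊗V ΠV-blockInvariant

  lumpedPath-closed : ∀ {m} {Y : Mat Act n m} →
    LeftClosed SameBlock Y → LeftClosed Π Y → LeftClosed (V ⊗ star Q ⊗ transpose V) Y
  lumpedPath-closed = leftClosed-lumpedPath ΠV-blockInvariant

  star-lump-A : star Q ⊗ lump A ⊗ star Q ≈ transpose V ⊗ Π ⊗ A ⊗ Π ⊗ V
  star-lump-A k l a = mk⇔ lumped⊆closed closed⊆lumped
    where
    lumped⊆closed : (star Q ⊗ lump A ⊗ star Q) k l a → (transpose V ⊗ Π ⊗ A ⊗ Π ⊗ V) k l a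
    lumped⊆closed (m , (p , q₁ , (j , (i , vip , α) , vjm)) , q₂) =
      let (x , vxk) = block-inhabited k
          (w , (z , (s , πxs , α') , πzw) , vwm) =
            close (lumpedPath-closed ΠAΠV-blockInvariant
                     (⊗-leftClosed (⊗-leftClosed (⊗-leftClosed star-leftClosed))))
              (p , (k , vxk , q₁) , vip) (j , (j , (i , star-refl , α) , star-refl) , vjm)
          (u , πwu , vul) = lift (m , vwm , q₂)
      in u , (z , (s , (x , vxk , πxs) , α') , star-trans πzw πwu) , vul

    closed⊆lumped : (transpose V ⊗ Π ⊗ A ⊗ Π ⊗ V) k l a → (star Q ⊗ lump A ⊗ star Q) k l a
    closed⊆lumped (u , (z , (s , (x , vxk , πxs) , α) , πzu) , vul) =
      block z , (block s , lump-star⊆star-lump (s , (x , vxk , πxs) , V-block s)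
                         , (z , (s , V-block s , α) , V-block z))
              , lump-star⊆star-lump (u , (z , V-block z , πzu) , vul)

  lump-ρ : transpose V ⊗ Π ⊗ ρ ≈ star Q ⊗ (transpose V ⊗ ρ)
  lump-ρ k c a = mk⇔ closed⊆lumped lumped⊆closed
    where
    closed⊆lumped : (transpose V ⊗ Π ⊗ ρ) k c a → (star Q ⊗ (transpose V ⊗ ρ)) k c a
    closed⊆lumped (j , (i , vik , πij) , r) =
      block j , lump-star⊆star-lump (j , (i , vik , πij) , V-block j) , (j , V-block j , r)

    lumped⊆closed : (star Q ⊗ (transpose V ⊗ ρ)) k c a → (transpose V ⊗ Π ⊗ ρ) k c a
    lumped⊆closed (p , q , (j , vjp , r)) =
      let (x , vxk) = block-inhabited k
          (w , πxw , r') = close (lumpedPath-closed Πρ-blockInvariant (⊗-leftClosed star-leftClosed))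
                             (p , (k , vxk , q) , vjp) (j , star-refl , r)
      in w , (x , vxk , πxw) , r'

mainTheorem2 : (Act : Set) (τ : Act) (n N : ℕ)
    (σ : Mat Act 1 n) (A S : Mat Act n n) (ρ : Mat Act n 1) (V : Mat Act n N) →
    IsTSSilent τ σ A S ρ →
    IsCollector V →
    Σ (Mat Act N n) (λ U → IsWeakBisimVia A S ρ V U) →
    (star (transpose V ⊗ S ⊗ V) ⊗ (transpose V ⊗ A ⊗ V) ⊗ star (transpose V ⊗ S ⊗ V)
    ≈ transpose V ⊗ star S ⊗ A ⊗ star S ⊗ V)
    × (transpose V ⊗ star S ⊗ ρ ≈ star (transpose V ⊗ S ⊗ V) ⊗ (transpose V ⊗ ρ))
mainTheorem2 Act τ n N σ A S ρ V _ col (U , bisim) = star-lump-A , lump-ρ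
  where open WeakBisimulation col bisim
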